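{- Let $m \geq 1$, let $(a_1,\dots,a_n)$ be a sequence of positive integers, let $\mathcal{G} = \mathcal{G}[a_1,\dots,a_n]$ be the associated border strip, and let \[ X_{\mathcal{G}}(q) = \Lambda_m^+(q,a_1)\Lambda_m^-(q,a_2)\Lambda_m^+(q,a_3)\Lambda_m^-(q,a_4)\cdots\Lambda_m^{\pm}(q,a_n), \] the factors alternating between $\Lambda_m^+$ (odd positions) and $\Lambda_m^-$ (even positions). Then for all $1 \leq i,j \leq m+1$, \[ X_{\mathcal{G}}(q)_{ij} = \begin{cases} q^{m+1-j}\, \Omega_m^{ij}(\mathcal{G},q) & \text{if } n \text{ is even},\\ q^{j-1}\, \overline{\Omega}_m^{ij}(\mathcal{G},q) & \text{if } n \text{ is odd}. \end{cases} \]
   Context: Matrices (all $(m+1)\times(m+1)$, indices $1,\dots,m+1$): $R_m$ is upper triangular with all entries on/above the diagonal equal to $1$; $L_m = R_m^\top$; $Q_m = \mathrm{diag}(q^m,q^{m-1},\dots,q,1)$; $R_m(q) = R_mQ_m$, $L_m(q) = L_mQ_m$; $W_m$ is the anti-diagonal permutation matrix (ones on the anti-diagonal, zeros elsewhere). For a positive integer $a$, $\Lambda_m^+(q,a) := R_m(q)^aW_m$ and $\Lambda_m^-(q,a) := W_mL_m(q)^a$. Border strip: for positive integers $a_1,\dots,a_n$, $\mathcal{G}[a_1,\dots,a_n]$ is a set of unit boxes $b_1,\dots,b_N$ in the plane with $N = a_1+\cdots+a_n-1$. If $n=1$, it is a vertical column of $a_1-1$ boxes, indexed bottom to top. If $n\geq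 2$, each box $b_{t+1}$ is placed either directly above or directly to the right of $b_t$, with the sequence of steps being: $a_1-1$ up steps, then $a_2$ right steps, then $a_3$ up steps, then $a_4$ right steps, etc., alternating, and ending with $a_n-1$ steps (right if $n$ is even, up if $n$ is odd). Thus boxes are indexed from bottom-left to top-right. A $P$-partition (reverse plane partition) of $\mathcal{G}$ with parts at most $m$ is a map $\sigma$ from the boxes to $\{0,1,\dots,m\}$ that is weakly increasing along each row from left to right and along each column from top to bottom. Its weight is $\mathrm{wt}(\sigma) = \sum_t \sigma(b_t)$. Let $\Omega_m(\mathcal{G})$ be the set of these. $\Omega_m^{ij}(\mathcal{G})$ is the subset with $\sigma(b_1) \leq m+1-i$ and $\sigma(b_N) \leq m+1-j$; $\overline{\Omega}_m^{ij}(\mathcal{G})$ is the subset with $\sigma(b_1) \leq m+1-i$ and $\sigma(b_N) \geq j-1$. The generating functions are $\Omega_m^{ij}(\mathcal{G},q) = \sum_{\sigma \in \Omega_m^{ij}(\mathcal{G})} q^{\mathrm{wt}(\sigma)}$ and similarly $\overline{\Omega}_m^{ij}(\mathcal{G},q)$. -}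

module Defs where

open import Level using (Level)
open import Algebra.Bundles using (CommutativeSemiring)
open import Data.Nat using () renaming (_+_ to _+ℕ_)
open import Data.Nat using (ℕ; zero; suc; _∸_; _≤_; _<_; _≤?_; _<?_; _≟_)
open import Data.Fin using (Fin; zero; suc; toℕ; fromℕ)
open import Data.Fin.Properties using (all?)
open import Data.List using (List; []; _∷_; _++_; replicate; take; length)
open import Data.Nat.ListAction using (sum)
open import Data.Bool using (Bool; true; false; not; if_then_else_)
open import Data.Unit using (⊤; tt)
open import Data.Product using (_×_)
open import Relation.Binary.PropositionalEquality using (_≡_)
open import Relation.Nullary using (Dec; does; yes)
open import Relation.Nullary.Decidable using (_×-dec_; _→-dec_)

isEven : ℕ → Bool
isEven zero = true
isEven (suc n) = not (isEven n)

-- Border strip G[a₁,…,aₙ]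
-- A step is `true` for an up step and `false` for a right step.

stepsAux : Bool → List ℕ → List Bool
stepsAux d [] = []
stepsAux d (a ∷ []) = replicate (a ∸ 1) d
stepsAux d (a ∷ b ∷ rest) = replicate a d ++ stepsAux (not d) (b ∷ rest)

-- the sequence of N - 1 steps from b_t to b_{t+1}
steps : List ℕ → List Bool
steps [] = []
steps (a₁ ∷ []) = replicate (a₁ ∸ 2) true
steps (a₁ ∷ a₂ ∷ rest) = replicate (a₁ ∸ 1) true ++ stepsAux false (a₂ ∷ rest)

nBoxes : List ℕ → ℕ
nBoxes a = sum a ∸ 1

countUp : List Bool → ℕ
countUp [] = 0
countUp (true ∷ s) = suc (countUp s)
countUp (false ∷ s) = countUp s

countRight : List Bool → ℕ
countRight [] = 0
countRight (true ∷ s) = countRight s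
countRight (false ∷ s) = suc (countRight s)

-- coordinates of box b_{t+1} (0-based index t), b₁ at the origin
xCoord : List ℕ → ℕ → ℕ
xCoord a t = countRight (take t (steps a))

yCoord : List ℕ → ℕ → ℕ
yCoord a t = countUp (take t (steps a))

-- Fillings σ : boxes → {0,…,m}  (box b_{t+1} ↔ t : Fin N, value v ↔ toℕ v)

Filling : ℕ → ℕ → Set
Filling m N = Fin N → Fin (suc m)

RowOK : (m : ℕ) (a : List ℕ) → Filling m (nBoxes a) → Set
RowOK m a σ = ∀ s t → yCoord a (toℕ s) ≡ yCoord a (toℕ t) →
  xCoord a (toℕ s) < xCoord a (toℕ t) → toℕ (σ s) ≤ toℕ (σ t)

ColOK : (m : ℕ) (a : List ℕ) → Filling m (nBoxes a) → Set
ColOK m a σ = ∀ s t → xCoord a (toℕ s) ≡ xCoord a (toℕ t) →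
  yCoord a (toℕ t) < yCoord a (toℕ s) → toℕ (σ s) ≤ toℕ (σ t)

IsPPartition : (m : ℕ) (a : List ℕ) → Filling m (nBoxes a) → Set
IsPPartition m a σ = RowOK m a σ × ColOK m a σ

isPPartition? : (m : ℕ) (a : List ℕ) (σ : Filling m (nBoxes a)) → Dec (IsPPartition m a σ)
isPPartition? m a σ =
  (all? λ s → all? λ t →
     (yCoord a (toℕ s) ≟ yCoord a (toℕ t)) →-dec
     (xCoord a (toℕ s) <? xCoord a (toℕ t)) →-dec (toℕ (σ s) ≤? toℕ (σ t)))
  ×-dec
  (all? λ s → all? λ t →
     (xCoord a (toℕ s) ≟ xCoord a (toℕ t)) →-dec
     (yCoord a (toℕ t) <? yCoord a (toℕ s)) →-dec (toℕ (σ s) ≤? toℕ (σ t)))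

-- Endpoint conditions, for i j : Fin (suc m) encoding the 1-based indices
-- i' = toℕ i + 1, j' = toℕ j + 1.
-- Ω^{ij}:  σ(b₁) ≤ m+1-i'  and  σ(b_N) ≤ m+1-j'
EndsΩ : (m N : ℕ) → Fin (suc m) → Fin (suc m) → Filling m N → Set
EndsΩ m zero i j σ = ⊤          -- empty strip (never occurs for even n)
EndsΩ m (suc N) i j σ = (toℕ (σ zero) ≤ m ∸ toℕ i) × (toℕ (σ (fromℕ N)) ≤ m ∸ toℕ j)

endsΩ? : (m N : ℕ) (i j : Fin (suc m)) (σ : Filling m N) → Dec (EndsΩ m N i j σ)
endsΩ? m zero i j σ = yes tt
endsΩ? m (suc N) i j σ = (toℕ (σ zero) ≤? m ∸ toℕ i) ×-dec (toℕ (σ (fromℕ N)) ≤? m ∸ toℕ j)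

-- Ω̄^{ij}:  σ(b₁) ≤ m+1-i'  and  σ(b_N) ≥ j'-1
-- For the empty strip (n = 1, a₁ = 1) the two bounds collapse to j'-1 ≤ m+1-i'.
EndsΩbar : (m N : ℕ) → Fin (suc m) → Fin (suc m) → Filling m N → Set
EndsΩbar m zero i j σ = toℕ j ≤ m ∸ toℕ i
EndsΩbar m (suc N) i j σ = (toℕ (σ zero) ≤ m ∸ toℕ i) × (toℕ j ≤ toℕ (σ (fromℕ N)))

endsΩbar? : (m N : ℕ) (i j : Fin (suc m)) (σ : Filling m N) → Dec (EndsΩbar m N i j σ)
endsΩbar? m zero i j σ = toℕ j ≤? m ∸ toℕ i
endsΩbar? m (suc N) i j σ = (toℕ (σ zero) ≤? m ∸ toℕ i) ×-dec (toℕ j ≤? toℕ (σ (fromℕ N)))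

sumℕ : (N : ℕ) → (Fin N → ℕ) → ℕ
sumℕ zero f = 0
sumℕ (suc N) f = f zero +ℕ sumℕ N (λ t → f (suc t))

wt : {m N : ℕ} → Filling m N → ℕ
wt {N = N} σ = sumℕ N (λ t → toℕ (σ t))

-- Everything over an arbitrary commutative semiring (q an element of it).
-- A polynomial identity in ℕ[q] is the same as an identity holding for every
-- element q of every commutative semiring.

module Over {c ℓ : Level} (R : CommutativeSemiring c ℓ) where
  open CommutativeSemiring R using (Carrier; _≈_; _+_; _*_; 0#; 1#)

  pow : Carrier → ℕ → Carrier
  pow x zero = 1#
  pow x (suc n) = x * pow x n

  sumFin : (k : ℕ) → (Fin k → Carrier) → Carrier
  sumFin zero f = 0#
  sumFin (suc k) f = f zero + sumFin k (λ t → f (suc t))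

  consF : {m N : ℕ} → Fin (suc m) → Filling m N → Filling m (suc N)
  consF v g zero = v
  consF v g (suc t) = g t

  sumFillings : (m N : ℕ) → (Filling m N → Carrier) → Carrier
  sumFillings m zero f = f (λ ())
  sumFillings m (suc N) f = sumFin (suc m) (λ v → sumFillings m N (λ g → f (consF v g)))

  [_] : {A : Set} → Dec A → Carrier
  [ d ] = if does d then 1# else 0#

  Ω : Carrier → (m : ℕ) → List ℕ → Fin (suc m) → Fin (suc m) → Carrier
  Ω q m a i j = sumFillings m (nBoxes a) λ σ →
    [ isPPartition? m a σ ×-dec endsΩ? m (nBoxes a) i j σ ] * pow q (wt σ)

  Ωbar : Carrier → (m : ℕ) → List ℕ → Fin (suc m) → Fin (suc m) → Carrier
  Ωbar q m a i j = sumFillings m (nBoxes a) λ σ →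
    [ isPPartition? m a σ ×-dec endsΩbar? m (nBoxes a) i j σ ] * pow q (wt σ)

  -- (m+1)×(m+1) matrices, index k : Fin (suc m) standing for k+1
  Mat : ℕ → Set c
  Mat m = Fin (suc m) → Fin (suc m) → Carrier

  _⊗_ : {m : ℕ} → Mat m → Mat m → Mat m
  _⊗_ {m} A B i j = sumFin (suc m) (λ k → A i k * B k j)

  I : (m : ℕ) → Mat m
  I m i j = [ toℕ i ≟ toℕ j ]

  matPow : {m : ℕ} → Mat m → ℕ → Mat m
  matPow {m} A zero = I m
  matPow A (suc n) = A ⊗ matPow A n

  -- R_m(q) = R_m Q_m : entry (i,j) = [i ≤ j] q^{m+1-j}
  Rq : Carrier → (m : ℕ) → Mat m
  Rq q m i j = [ toℕ i ≤? toℕ j ] * pow q (m ∸ toℕ j)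

  -- L_m(q) = L_m Q_m : entry (i,j) = [i ≥ j] q^{m+1-j}
  Lq : Carrier → (m : ℕ) → Mat m
  Lq q m i j = [ toℕ j ≤? toℕ i ] * pow q (m ∸ toℕ j)

  W : (m : ℕ) → Mat m
  W m i j = [ toℕ i +ℕ toℕ j ≟ m ]

  Λ⁺ : Carrier → (m : ℕ) → ℕ → Mat m
  Λ⁺ q m a = matPow (Rq q m) a ⊗ W m

  Λ⁻ : Carrier → (m : ℕ) → ℕ → Mat m
  Λ⁻ q m a = W m ⊗ matPow (Lq q m) a

  -- alternating product; Bool = true means the next factor is Λ⁺
  Xalt : Carrier → (m : ℕ) → Bool → List ℕ → Mat m
  Xalt q m s [] = I m
  Xalt q m true (a ∷ as) = Λ⁺ q m a ⊗ Xalt q m false as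
  Xalt q m false (a ∷ as) = Λ⁻ q m a ⊗ Xalt q m true as

  X : Carrier → (m : ℕ) → List ℕ → Mat m
  X q m a = Xalt q m true a

{-# OPTIONS --safe #-}
module Submission where

-- Conjugated by the reversal W, the matrices R_m(q) and L_m(q) become the transfer
-- matrices T↑ v w = [w ≤ v] q^w and T→ v w = [v ≤ w] q^w (v, w ∈ {0,…,m}) of an up and
-- a right step, and since W² = 1 the W's between consecutive factors cancel. So
-- X_G(q)_{ij} is the entry, at the value m+1-i, of a product of transfer matrices along a
-- word of steps (an up step, the steps of G, one final step) applied to a unit vector.
-- Expanding the product sums q^{σ(b₁)+⋯+σ(b_N)} over the fillings in which each pair of
-- consecutive boxes satisfies the inequality of the step between them, and for a border
-- strip these local inequalities are exactly the P-partition conditions. The leading up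
-- step from the value m+1-i imposes σ(b₁) ≤ m+1-i; the final step against the unit vector
-- yields the condition on σ(b_N) together with the factor q^{m+1-j} (n even) or q^{j-1}
-- (n odd).

open import Defs
open import Algebra.Bundles using (CommutativeSemiring)
open import Data.Nat as ℕ using (ℕ; zero; suc; _≤_; _<_; _∸_; z≤n; s≤s) renaming (_+_ to _+ℕ_)
import Data.Nat.Properties as ℕₚ
import Data.Nat.ListAction as ℕₗ
open import Data.Fin as Fin using (Fin; zero; suc; toℕ; fromℕ; opposite)
import Data.Fin.Properties as Finₚ
import Data.Fin.Permutation as Perm
open import Data.List as List using (List; []; _∷_; _++_; replicate; take; length)
import Data.List.Properties as Listₚ
open import Data.List.Relation.Unary.All using (All; _∷_)
open import Data.Bool using (Bool; true; false; not; if_then_else_)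
import Data.Bool.Properties as Boolₚ
open import Data.Product using (_×_; _,_; proj₁; proj₂)
open import Data.Sum using (_⊎_; inj₁; inj₂)
open import Data.Unit using (⊤; tt)
open import Data.Vec.Functional using (Vector)
open import Function using (_∘_; _⇔_; mk⇔; Equivalence)
open import Relation.Nullary using (Dec; yes; _because_)
open import Relation.Nullary.Decidable using (_×-dec_; does-⇔)
open import Relation.Binary.PropositionalEquality as ≡ using (_≡_; refl; cong)

Compatible : ∀ {k} → Bool → Fin k → Fin k → Set
Compatible true  v w = toℕ w ≤ toℕ v
Compatible false v w = toℕ v ≤ toℕ w

compatible? : ∀ {k} d (v w : Fin k) → Dec (Compatible d v w)
compatible? true  v w = toℕ w ℕ.≤? toℕ v
compatible? false v w = toℕ v ℕ.≤? toℕ w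

Chain : ∀ {k} (s : List Bool) → (Fin (suc (length s)) → Fin k) → Set
Chain []      σ = ⊤
Chain (d ∷ s) σ = Compatible d (σ zero) (σ (suc zero)) × Chain s (σ ∘ suc)

chain? : ∀ {k} s (σ : Fin (suc (length s)) → Fin k) → Dec (Chain s σ)
chain? []      σ = yes tt
chain? (d ∷ s) σ = compatible? d (σ zero) (σ (suc zero)) ×-dec chain? s (σ ∘ suc)

xAlong yAlong : List Bool → ℕ → ℕ
xAlong s t = countRight (take t s)
yAlong s t = countUp (take t s)

-- IsPPartition m a σ unfolds to IsPPartitionAlong (nBoxes a) (steps a) σ.
IsPPartitionAlong : ∀ {k} (N : ℕ) (s : List Bool) → (Fin N → Fin k) → Set
IsPPartitionAlong N s σ =
  (∀ p t → yAlong s (toℕ p) ≡ yAlong s (toℕ t) → xAlong s (toℕ p) < xAlong s (toℕ t) →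
           toℕ (σ p) ≤ toℕ (σ t)) ×
  (∀ p t → xAlong s (toℕ p) ≡ xAlong s (toℕ t) → yAlong s (toℕ t) < yAlong s (toℕ p) →
           toℕ (σ p) ≤ toℕ (σ t))

xAlong≡0⇒yAlong>0 : ∀ s (t : Fin (length s)) → xAlong s (suc (toℕ t)) ≡ 0 → 0 < yAlong s (suc (toℕ t))
xAlong≡0⇒yAlong>0 (true ∷ s) t _ = s≤s z≤n
xAlong≡0⇒yAlong>0 (false ∷ s) t ()

yAlong≡0⇒xAlong>0 : ∀ s (t : Fin (length s)) → yAlong s (suc (toℕ t)) ≡ 0 → 0 < xAlong s (suc (toℕ t))
yAlong≡0⇒xAlong>0 (true ∷ s) t ()
yAlong≡0⇒xAlong>0 (false ∷ s) t _ = s≤s z≤n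

module _ {k : ℕ} where

  pPartition⇒chain : ∀ s (σ : Fin (suc (length s)) → Fin k) → IsPPartitionAlong _ s σ → Chain s σ
  pPartition⇒chain []          σ _           = tt
  pPartition⇒chain (true ∷ s)  σ (row , col) =
    col (suc zero) zero refl (s≤s z≤n) ,
    pPartition⇒chain s (σ ∘ suc) ((λ p t ey lx → row (suc p) (suc t) (cong suc ey) lx) ,
                                  (λ p t ex ly → col (suc p) (suc t) ex (s≤s ly)))
  pPartition⇒chain (false ∷ s) σ (row , col) =
    row zero (suc zero) refl (s≤s z≤n) ,
    pPartition⇒chain s (σ ∘ suc) ((λ p t ey lx → row (suc p) (suc t) ey (s≤s lx)) ,
                                  (λ p t ex ly → col (suc p) (suc t) (cong suc ex) ly))

  chain⇒pPartition : ∀ s (σ : Fin (suc (length s)) → Fin k) → Chain s σ → IsPPartitionAlong _ s σ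
  chain⇒pPartition []          σ tt = (λ { zero zero _ () }) , (λ { zero zero _ () })
  chain⇒pPartition (true ∷ s)  σ (σ₁≤σ₀ , chain) = row , col
    where
    rest = chain⇒pPartition s (σ ∘ suc) chain
    row : ∀ p t → yAlong (true ∷ s) (toℕ p) ≡ yAlong (true ∷ s) (toℕ t) →
          xAlong (true ∷ s) (toℕ p) < xAlong (true ∷ s) (toℕ t) → toℕ (σ p) ≤ toℕ (σ t)
    row zero    (suc t) ()
    row (suc p) (suc t) ey lx = proj₁ rest p t (ℕₚ.suc-injective ey) lx
    col : ∀ p t → xAlong (true ∷ s) (toℕ p) ≡ xAlong (true ∷ s) (toℕ t) →
          yAlong (true ∷ s) (toℕ t) < yAlong (true ∷ s) (toℕ p) → toℕ (σ p) ≤ toℕ (σ t)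
    col (suc zero)     zero    _  _  = σ₁≤σ₀
    col (suc (suc p))  zero    ex _  =
      ℕₚ.≤-trans (proj₂ rest (suc p) zero ex (xAlong≡0⇒yAlong>0 s p ex)) σ₁≤σ₀
    col (suc p)        (suc t) ex ly = proj₂ rest p t ex (ℕₚ.≤-pred ly)
  chain⇒pPartition (false ∷ s) σ (σ₀≤σ₁ , chain) = row , col
    where
    rest = chain⇒pPartition s (σ ∘ suc) chain
    row : ∀ p t → yAlong (false ∷ s) (toℕ p) ≡ yAlong (false ∷ s) (toℕ t) →
          xAlong (false ∷ s) (toℕ p) < xAlong (false ∷ s) (toℕ t) → toℕ (σ p) ≤ toℕ (σ t)
    row zero    (suc zero)    _  _  = σ₀≤σ₁
    row zero    (suc (suc t)) ey _  =
      ℕₚ.≤-trans σ₀≤σ₁ (proj₁ rest zero (suc t) ey (yAlong≡0⇒xAlong>0 s t (≡.sym ey)))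
    row (suc p) (suc t)       ey lx = proj₁ rest p t ey (ℕₚ.≤-pred lx)
    col : ∀ p t → xAlong (false ∷ s) (toℕ p) ≡ xAlong (false ∷ s) (toℕ t) →
          yAlong (false ∷ s) (toℕ t) < yAlong (false ∷ s) (toℕ p) → toℕ (σ p) ≤ toℕ (σ t)
    col (suc p) zero    ()
    col (suc p) (suc t) ex ly = proj₂ rest p t (ℕₚ.suc-injective ex) ly

chain⇔pPartition : ∀ {k} s (σ : Fin (suc (length s)) → Fin k) → Chain s σ ⇔ IsPPartitionAlong _ s σ
chain⇔pPartition s σ = mk⇔ (chain⇒pPartition s σ) (pPartition⇒chain s σ)

blocks : Bool → List ℕ → List Bool
blocks d []       = []
blocks d (a ∷ as) = replicate a d ++ blocks (not d) as

flipPerBlock : Bool → List ℕ → Bool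
flipPerBlock d []       = d
flipPerBlock d (a ∷ as) = flipPerBlock (not d) as

flipPerBlock-not : ∀ d as → flipPerBlock (not d) as ≡ not (flipPerBlock d as)
flipPerBlock-not d []       = refl
flipPerBlock-not d (a ∷ as) = flipPerBlock-not (not d) as

flipPerBlock-true : ∀ as → flipPerBlock true as ≡ isEven (length as)
flipPerBlock-true []       = refl
flipPerBlock-true (a ∷ as) = ≡.trans (flipPerBlock-not true as) (cong not (flipPerBlock-true as))

length-blocks : ∀ d as → length (blocks d as) ≡ ℕₗ.sum as
length-blocks d []       = refl
length-blocks d (a ∷ as) = ≡.trans (Listₚ.length-++ (replicate a d))
  (≡.cong₂ _+ℕ_ (Listₚ.length-replicate a) (length-blocks (not d) as))

replicate-snoc : ∀ {A : Set} n (x : A) → replicate n x ++ x ∷ [] ≡ x ∷ replicate n x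
replicate-snoc zero    x = refl
replicate-snoc (suc n) x = cong (x ∷_) (replicate-snoc n x)

stepsAux-snoc : ∀ d a as → All (1 ≤_) (a ∷ as) →
  stepsAux d (a ∷ as) ++ not (flipPerBlock d (a ∷ as)) ∷ [] ≡ blocks d (a ∷ as)
stepsAux-snoc d (suc a) [] _ = begin
  replicate a d ++ not (not d) ∷ [] ≡⟨ cong (λ x → replicate a d ++ x ∷ []) (Boolₚ.not-involutive d) ⟩
  replicate a d ++ d ∷ []         ≡⟨ replicate-snoc a d ⟩
  replicate (suc a) d              ≡⟨ Listₚ.++-identityʳ _ ⟨
  replicate (suc a) d ++ []        ∎
  where open ≡.≡-Reasoning
stepsAux-snoc d a (b ∷ as) (_ ∷ pos) =
  ≡.trans (Listₚ.++-assoc (replicate a d) (stepsAux (not d) (b ∷ as)) _)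
          (cong (replicate a d ++_) (stepsAux-snoc (not d) b as pos))

blocks-shape : ∀ a → 1 ≤ length a → All (1 ≤_) a →
  a ≡ 1 ∷ [] ⊎ blocks true a ≡ true ∷ (steps a ++ not (flipPerBlock true a) ∷ [])
blocks-shape []                 () _
blocks-shape (zero ∷ _)         _ (() ∷ _)
blocks-shape (suc zero ∷ [])    _ _ = inj₁ refl
blocks-shape (suc (suc b) ∷ []) _ _ =
  inj₂ (cong (true ∷_) (≡.trans (Listₚ.++-identityʳ _) (≡.sym (replicate-snoc b true))))
blocks-shape (suc a ∷ b ∷ as)   _ (_ ∷ pos) = inj₂ (cong (true ∷_) (≡.sym
  (≡.trans (Listₚ.++-assoc (replicate a true) (stepsAux false (b ∷ as)) _)
           (cong (replicate a true ++_) (stepsAux-snoc false b as pos)))))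

nBoxes-shape : ∀ a s d → blocks true a ≡ true ∷ (s ++ d ∷ []) → nBoxes a ≡ suc (length s)
nBoxes-shape a s d shape = begin
  ℕₗ.sum a ∸ 1                 ≡⟨ cong (_∸ 1) (length-blocks true a) ⟨
  length (blocks true a) ∸ 1   ≡⟨ cong (λ bs → length bs ∸ 1) shape ⟩
  length (s ++ d ∷ [])          ≡⟨ Listₚ.length-++ s ⟩
  length s +ℕ 1                ≡⟨ ℕₚ.+-comm (length s) 1 ⟩
  suc (length s)               ∎
  where open ≡.≡-Reasoning

module _ {m : ℕ} where

  toℕ-opposite : ∀ (i : Fin (suc m)) → toℕ (opposite i) ≡ m ∸ toℕ i
  toℕ-opposite = Finₚ.opposite-prop

  ≤⇔opposite-≥ : ∀ (i k : Fin (suc m)) → toℕ i ≤ toℕ k ⇔ toℕ (opposite k) ≤ toℕ (opposite i)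
  ≤⇔opposite-≥ i k rewrite toℕ-opposite i | toℕ-opposite k =
    mk⇔ (ℕₚ.∸-monoʳ-≤ m) (ℕₚ.∸-cancelʳ-≤ (Finₚ.toℕ≤pred[n] i))

  +≡⇔opposite : ∀ (i k : Fin (suc m)) → toℕ i +ℕ toℕ k ≡ m ⇔ k ≡ opposite i
  +≡⇔opposite i k = mk⇔ to from
    where
    to : toℕ i +ℕ toℕ k ≡ m → k ≡ opposite i
    to i+k≡m = Finₚ.toℕ-injective (begin
      toℕ k                   ≡⟨ ℕₚ.m+n∸m≡n (toℕ i) (toℕ k) ⟨
      toℕ i +ℕ toℕ k ∸ toℕ i  ≡⟨ cong (_∸ toℕ i) i+k≡m ⟩
      m ∸ toℕ i               ≡⟨ toℕ-opposite i ⟨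
      toℕ (opposite i)        ∎)
      where open ≡.≡-Reasoning
    from : k ≡ opposite i → toℕ i +ℕ toℕ k ≡ m
    from refl = ≡.trans (cong (toℕ i +ℕ_) (toℕ-opposite i)) (ℕₚ.m+[n∸m]≡n (Finₚ.toℕ≤pred[n] i))

module OverProperties {c ℓ} (R : CommutativeSemiring c ℓ) where
  open CommutativeSemiring R hiding (zero) renaming (refl to ≈-refl; sym to ≈-sym; trans to ≈-trans)
  open Over R
  open import Algebra.Properties.Semiring.Sum semiring using (sum; ∑-comm; ∑-permute; sum-cong-≗)
  open import Algebra.Properties.Semiring.Exp semiring using (_^_; ^-homo-*)
  open import Relation.Binary.Reasoning.Setoid setoid

  []-×-dec : ∀ {A B : Set} (a? : Dec A) (b? : Dec B) → [ a? ×-dec b? ] ≈ [ a? ] * [ b? ]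
  []-×-dec (true  because _) b? = ≈-sym (*-identityˡ _)
  []-×-dec (false because _) b? = ≈-sym (zeroˡ _)

  []-⇔ : ∀ {A B : Set} → A ⇔ B → (a? : Dec A) (b? : Dec B) → [ a? ] ≡ [ b? ]
  []-⇔ A⇔B a? b? = cong (λ b → if b then 1# else 0#) (does-⇔ A⇔B a? b?)

  sumFin≡sum : ∀ n (f : Fin n → Carrier) → sumFin n f ≡ sum f
  sumFin≡sum zero    f = refl
  sumFin≡sum (suc n) f = cong (f zero +_) (sumFin≡sum n (f ∘ suc))

  sumFin-cong : ∀ n {f g : Fin n → Carrier} → (∀ k → f k ≈ g k) → sumFin n f ≈ sumFin n g
  sumFin-cong zero    f≈g = ≈-refl
  sumFin-cong (suc n) f≈g = +-cong (f≈g zero) (sumFin-cong n (f≈g ∘ suc))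

  sumFin-*ˡ : ∀ n x (f : Fin n → Carrier) → x * sumFin n f ≈ sumFin n (λ k → x * f k)
  sumFin-*ˡ zero    x f = zeroʳ x
  sumFin-*ˡ (suc n) x f = ≈-trans (distribˡ x _ _) (+-congˡ (sumFin-*ˡ n x (f ∘ suc)))

  sumFin-*ʳ : ∀ n x (f : Fin n → Carrier) → sumFin n f * x ≈ sumFin n (λ k → f k * x)
  sumFin-*ʳ zero    x f = zeroˡ x
  sumFin-*ʳ (suc n) x f = ≈-trans (distribʳ x _ _) (+-congˡ (sumFin-*ʳ n x (f ∘ suc)))

  sumFin-comm : ∀ n p (f : Fin n → Fin p → Carrier) →
    sumFin n (λ k → sumFin p (f k)) ≈ sumFin p (λ l → sumFin n (λ k → f k l))
  sumFin-comm n p f = begin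
    sumFin n (λ k → sumFin p (f k))       ≡⟨ sumFin²≡sum² n p f ⟩
    sum (λ k → sum (f k))                 ≈⟨ ∑-comm f ⟩
    sum (λ l → sum (λ k → f k l))         ≡⟨ sumFin²≡sum² p n (λ l k → f k l) ⟨
    sumFin p (λ l → sumFin n (λ k → f k l)) ∎
    where
    sumFin²≡sum² : ∀ n p (f : Fin n → Fin p → Carrier) →
      sumFin n (λ k → sumFin p (f k)) ≡ sum (λ k → sum (f k))
    sumFin²≡sum² n p f = ≡.trans (sumFin≡sum n _) (sum-cong-≗ (λ k → sumFin≡sum p (f k)))

  sumFin-opposite : ∀ n (f : Fin n → Carrier) → sumFin n (f ∘ opposite) ≈ sumFin n f
  sumFin-opposite n f = begin
    sumFin n (f ∘ opposite) ≡⟨ sumFin≡sum n _ ⟩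
    sum (f ∘ opposite)      ≈⟨ ∑-permute f Perm.reverse ⟨
    sum f                   ≡⟨ sumFin≡sum n f ⟨
    sumFin n f              ∎

  pow≡^ : ∀ x n → pow x n ≡ x ^ n
  pow≡^ x zero    = refl
  pow≡^ x (suc n) = cong (x *_) (pow≡^ x n)

  pow-+ : ∀ x a b → pow x (a +ℕ b) ≈ pow x a * pow x b
  pow-+ x a b = begin
    pow x (a +ℕ b)        ≡⟨ pow≡^ x (a +ℕ b) ⟩
    x ^ (a +ℕ b)          ≈⟨ ^-homo-* x a b ⟩
    x ^ a * x ^ b         ≡⟨ ≡.cong₂ _*_ (pow≡^ x a) (pow≡^ x b) ⟨
    pow x a * pow x b     ∎

  sumFin-δ : ∀ {n} {P : Fin n → Set} (P? : ∀ k → Dec (P k)) (k₀ : Fin n) → (∀ k → P k ⇔ k ≡ k₀) →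
    (f : Fin n → Carrier) → sumFin n (λ k → [ P? k ] * f k) ≈ f k₀
  sumFin-δ {n} P? k₀ P⇔ f =
    ≈-trans (sumFin-cong n (λ k → *-congʳ (reflexive ([]-⇔ (P⇔ k) (P? k) (k Fin.≟ k₀))))) (δ k₀ f)
    where
    δ : ∀ {n} (k₀ : Fin n) (f : Fin n → Carrier) → sumFin n (λ k → [ k Fin.≟ k₀ ] * f k) ≈ f k₀
    δ {suc n} zero f = begin
      1# * f zero + sumFin n (λ k → 0# * f (suc k))
        ≈⟨ +-cong (*-identityˡ _) (≈-sym (sumFin-*ˡ n 0# (f ∘ suc))) ⟩
      f zero + 0# * sumFin n (f ∘ suc)
        ≈⟨ +-congˡ (zeroˡ _) ⟩
      f zero + 0#
        ≈⟨ +-identityʳ _ ⟩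
      f zero ∎
    δ {suc n} (suc k₀) f = begin
      0# * f zero + sumFin n (λ k → [ k Fin.≟ k₀ ] * f (suc k))
        ≈⟨ +-cong (zeroˡ _) (δ k₀ (f ∘ suc)) ⟩
      0# + f (suc k₀)
        ≈⟨ +-identityˡ _ ⟩
      f (suc k₀) ∎

  sumFin-δʳ : ∀ {n} {P : Fin n → Set} (P? : ∀ k → Dec (P k)) (k₀ : Fin n) → (∀ k → P k ⇔ k ≡ k₀) →
    (f : Fin n → Carrier) → sumFin n (λ k → f k * [ P? k ]) ≈ f k₀
  sumFin-δʳ {n} P? k₀ P⇔ f = ≈-trans (sumFin-cong n (λ k → *-comm (f k) _)) (sumFin-δ P? k₀ P⇔ f)

  sumFillings-cong : ∀ m N {f g : Filling m N → Carrier} → (∀ σ → f σ ≈ g σ) →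
    sumFillings m N f ≈ sumFillings m N g
  sumFillings-cong m zero    f≈g = f≈g _
  sumFillings-cong m (suc N) f≈g = sumFin-cong (suc m) (λ v → sumFillings-cong m N (λ σ → f≈g (consF v σ)))

  sumFillings-*ˡ : ∀ m N x (f : Filling m N → Carrier) →
    x * sumFillings m N f ≈ sumFillings m N (λ σ → x * f σ)
  sumFillings-*ˡ m zero    x f = ≈-refl
  sumFillings-*ˡ m (suc N) x f = ≈-trans
    (sumFin-*ˡ (suc m) x (λ v → sumFillings m N (f ∘ consF v)))
    (sumFin-cong (suc m) (λ v → sumFillings-*ˡ m N x (f ∘ consF v)))

module Transfer {c ℓ} (R : CommutativeSemiring c ℓ) (q : CommutativeSemiring.Carrier R) (m : ℕ) where
  open CommutativeSemiring R hiding (zero) renaming (refl to ≈-refl; sym to ≈-sym; trans to ≈-trans)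
  open Over R
  open OverProperties R
  open import Algebra.Solver.CommutativeMonoid *-commutativeMonoid using (solve; _⊜_; _⊕_)
  open import Algebra.Properties.CommutativeSemigroup *-commutativeSemigroup using (x∙yz≈y∙xz)
  open import Relation.Binary.Reasoning.Setoid setoid

  Column : Set c
  Column = Vector Carrier (suc m)

  unit : Fin (suc m) → Column
  unit j k = I m k j

  infixr 6 _▷_
  _▷_ : Mat m → Column → Column
  (A ▷ y) i = sumFin (suc m) (λ k → A i k * y k)

  ▷-congʳ : ∀ A {y y′ : Column} → (∀ k → y k ≈ y′ k) → ∀ i → (A ▷ y) i ≈ (A ▷ y′) i
  ▷-congʳ A y≈y′ i = sumFin-cong (suc m) (λ k → *-congˡ {A i k} (y≈y′ k))

  ⊗-▷ : ∀ (A B : Mat m) y i → ((A ⊗ B) ▷ y) i ≈ (A ▷ (B ▷ y)) i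
  ⊗-▷ A B y i = begin
    sumFin (suc m) (λ l → sumFin (suc m) (λ k → A i k * B k l) * y l)
      ≈⟨ sumFin-cong (suc m) (λ l → ≈-trans (sumFin-*ʳ (suc m) (y l) (λ k → A i k * B k l))
            (sumFin-cong (suc m) (λ k → *-assoc (A i k) (B k l) (y l)))) ⟩
    sumFin (suc m) (λ l → sumFin (suc m) (λ k → A i k * (B k l * y l)))
      ≈⟨ sumFin-comm (suc m) (suc m) (λ k l → A i k * (B k l * y l)) ⟨
    sumFin (suc m) (λ k → sumFin (suc m) (λ l → A i k * (B k l * y l)))
      ≈⟨ sumFin-cong (suc m) (λ k → ≈-sym (sumFin-*ˡ (suc m) (A i k) (λ l → B k l * y l))) ⟩
    sumFin (suc m) (λ k → A i k * (B ▷ y) k) ∎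

  I-▷ : ∀ y i → (I m ▷ y) i ≈ y i
  I-▷ y i = sumFin-δ (λ k → toℕ i ℕ.≟ toℕ k) i
    (λ k → mk⇔ (≡.sym ∘ Finₚ.toℕ-injective) (cong toℕ ∘ ≡.sym)) y

  I-▷-reversed : ∀ y i → (I m ▷ y) i ≈ (y ∘ opposite) (opposite i)
  I-▷-reversed y i = ≈-trans (I-▷ y i) (reflexive (cong y (≡.sym (Finₚ.opposite-involutive i))))

  W-▷ : ∀ y i → (W m ▷ y) i ≈ y (opposite i)
  W-▷ y i = sumFin-δ (λ k → toℕ i +ℕ toℕ k ℕ.≟ m) (opposite i) (+≡⇔opposite i) y

  ▷-unit : ∀ A i j → (A ▷ unit j) i ≈ A i j
  ▷-unit A i j =
    sumFin-δʳ (λ k → toℕ k ℕ.≟ toℕ j) j (λ k → mk⇔ Finₚ.toℕ-injective (cong toℕ)) (A i)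

  transferMatrix : Bool → Mat m
  transferMatrix d v w = [ compatible? d v w ] * pow q (toℕ w)

  transfer : Bool → Column → Column
  transfer d y = transferMatrix d ▷ y

  transferAlong : List Bool → Column → Column
  transferAlong s y = List.foldr transfer y s

  transferAlong-cong : ∀ s {y y′ : Column} → (∀ w → y w ≈ y′ w) →
    ∀ v → transferAlong s y v ≈ transferAlong s y′ v
  transferAlong-cong []      y≈y′ = y≈y′
  transferAlong-cong (d ∷ s) y≈y′ = ▷-congʳ (transferMatrix d) (transferAlong-cong s y≈y′)

  transferAlong-*ˡ : ∀ s x (y : Column) v → transferAlong s (λ w → x * y w) v ≈ x * transferAlong s y v
  transferAlong-*ˡ []      x y v = ≈-refl
  transferAlong-*ˡ (d ∷ s) x y v = begin
    (transferMatrix d ▷ transferAlong s (λ w → x * y w)) v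
      ≈⟨ ▷-congʳ (transferMatrix d) (transferAlong-*ˡ s x y) v ⟩
    sumFin (suc m) (λ w → transferMatrix d v w * (x * transferAlong s y w))
      ≈⟨ sumFin-cong (suc m) (λ w → x∙yz≈y∙xz (transferMatrix d v w) x (transferAlong s y w)) ⟩
    sumFin (suc m) (λ w → x * (transferMatrix d v w * transferAlong s y w))
      ≈⟨ sumFin-*ˡ (suc m) x (λ w → transferMatrix d v w * transferAlong s y w) ⟨
    x * transfer d (transferAlong s y) v ∎

  chainWeight : ∀ s → Column → Fin (suc m) → Filling m (length s) → Carrier
  chainWeight s y v σ = [ chain? s (consF v σ) ] * (y (consF v σ (fromℕ (length s))) * pow q (wt σ))

  chainWeight-∷ : ∀ d s y v w σ →
    chainWeight (d ∷ s) y v (consF w σ) ≈ transferMatrix d v w * chainWeight s y w σ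
  chainWeight-∷ d s y v w σ = ≈-trans
    (*-cong ([]-×-dec (compatible? d v w) (chain? s (consF w σ))) (*-congˡ (pow-+ q (toℕ w) (wt σ))))
    (solve 5 (λ a b x y z → (a ⊕ b) ⊕ (x ⊕ (y ⊕ z)) ⊜ (a ⊕ y) ⊕ (b ⊕ (x ⊕ z))) ≈-refl _ _ _ _ _)

  sumFillings-chain : ∀ s y v → sumFillings m (length s) (chainWeight s y v) ≈ transferAlong s y v
  sumFillings-chain []      y v = ≈-trans (*-identityˡ _) (*-identityʳ _)
  sumFillings-chain (d ∷ s) y v = sumFin-cong (suc m) λ w → begin
    sumFillings m n (chainWeight (d ∷ s) y v ∘ consF w)
      ≈⟨ sumFillings-cong m n (chainWeight-∷ d s y v w) ⟩
    sumFillings m n (λ σ → transferMatrix d v w * chainWeight s y w σ)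
      ≈⟨ sumFillings-*ˡ m n _ (chainWeight s y w) ⟨
    transferMatrix d v w * sumFillings m n (chainWeight s y w)
      ≈⟨ *-congˡ (sumFillings-chain s y w) ⟩
    transferMatrix d v w * transferAlong s y w ∎
    where
    n = length s

  -- The bound on σ(b₁) is a leading up step from the value opposite i = m - i.
  sumFillings-strip : ∀ s {E : Fin (suc m) → Set} (E? : ∀ w → Dec (E w))
    (pp? : ∀ σ → Dec (IsPPartitionAlong (suc (length s)) s σ)) i →
    sumFillings m (suc (length s)) (λ σ →
      [ pp? σ ×-dec ((toℕ (σ zero) ℕ.≤? m ∸ toℕ i) ×-dec E? (σ (fromℕ (length s)))) ] * pow q (wt σ))
    ≈ transferAlong (true ∷ s) (λ w → [ E? w ]) (opposite i)
  sumFillings-strip s {E} E? pp? i =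
    ≈-trans (sumFillings-cong m (suc (length s)) summand)
            (sumFillings-chain (true ∷ s) (λ w → [ E? w ]) (opposite i))
    where
    last = fromℕ (length s)
    ends? : ∀ σ → Dec _
    ends? σ = pp? σ ×-dec ((toℕ (σ zero) ℕ.≤? m ∸ toℕ i) ×-dec E? (σ last))
    chain₀? : ∀ σ → Dec _
    chain₀? σ = chain? (true ∷ s) (consF (opposite i) σ)
    ends⇔ : ∀ σ → (IsPPartitionAlong _ s σ × (toℕ (σ zero) ≤ m ∸ toℕ i) × E (σ last))
                ⇔ ((Compatible true (opposite i) (σ zero) × Chain s σ) × E (σ last))
    ends⇔ σ = mk⇔
      (λ (pp , first , e) →
        (≡.subst (_ ≤_) (≡.sym (toℕ-opposite i)) first , Equivalence.from (chain⇔pPartition s σ) pp) , e)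
      (λ ((first , ch) , e) →
        Equivalence.to (chain⇔pPartition s σ) ch , ≡.subst (_ ≤_) (toℕ-opposite i) first , e)
    summand : ∀ σ → [ ends? σ ] * pow q (wt σ) ≈ chainWeight (true ∷ s) (λ w → [ E? w ]) (opposite i) σ
    summand σ = begin
      [ ends? σ ] * pow q (wt σ)
        ≡⟨ cong (_* pow q (wt σ)) ([]-⇔ (ends⇔ σ) (ends? σ) (chain₀? σ ×-dec E? (σ last))) ⟩
      [ chain₀? σ ×-dec E? (σ last) ] * pow q (wt σ)
        ≈⟨ *-congʳ ([]-×-dec (chain₀? σ) (E? (σ last))) ⟩
      ([ chain₀? σ ] * [ E? (σ last) ]) * pow q (wt σ)
        ≈⟨ *-assoc _ _ _ ⟩
      [ chain₀? σ ] * ([ E? (σ last) ] * pow q (wt σ)) ∎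

  Rq-opposite : ∀ i k → Rq q m i k ≈ transferMatrix true (opposite i) (opposite k)
  Rq-opposite i k = *-cong
    (reflexive ([]-⇔ (≤⇔opposite-≥ i k) (toℕ i ℕ.≤? toℕ k) (compatible? true (opposite i) (opposite k))))
    (reflexive (cong (pow q) (≡.sym (toℕ-opposite k))))

  Lq-opposite : ∀ i k → Lq q m i k ≈ transferMatrix false (opposite i) (opposite k)
  Lq-opposite i k = *-cong
    (reflexive ([]-⇔ (≤⇔opposite-≥ k i) (toℕ k ℕ.≤? toℕ i) (compatible? false (opposite i) (opposite k))))
    (reflexive (cong (pow q) (≡.sym (toℕ-opposite k))))

  matPow-▷ : ∀ {A : Mat m} d → (∀ i k → A i k ≈ transferMatrix d (opposite i) (opposite k)) →
    ∀ a y i → (matPow A a ▷ y) i ≈ transferAlong (replicate a d) (y ∘ opposite) (opposite i)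
  matPow-▷ d A≈T zero y i = I-▷-reversed y i
  matPow-▷ {A} d A≈T (suc a) y i = begin
    ((A ⊗ matPow A a) ▷ y) i
      ≈⟨ ⊗-▷ A (matPow A a) y i ⟩
    (A ▷ (matPow A a ▷ y)) i
      ≈⟨ sumFin-cong (suc m) (λ k → *-cong (A≈T i k) (matPow-▷ d A≈T a y k)) ⟩
    sumFin (suc m) (λ k → transferMatrix d (opposite i) (opposite k) * z (opposite k))
      ≈⟨ sumFin-opposite (suc m) (λ w → transferMatrix d (opposite i) w * z w) ⟩
    transfer d z (opposite i) ∎
    where
    z = transferAlong (replicate a d) (y ∘ opposite)

  endVector : Bool → Column → Column
  endVector true  y = y ∘ opposite
  endVector false y = y

  Xalt-▷ : ∀ d as (y : Column) i →
    (Xalt q m d as ▷ y) i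
    ≈ transferAlong (blocks d as) (endVector (flipPerBlock d as) y) (if d then opposite i else i)
  Xalt-▷ true  []       y i = I-▷-reversed y i
  Xalt-▷ false []       y i = I-▷ y i
  Xalt-▷ true  (a ∷ as) y i = begin
    ((Λ⁺ q m a ⊗ Xalt q m false as) ▷ y) i
      ≈⟨ ⊗-▷ (Λ⁺ q m a) (Xalt q m false as) y i ⟩
    (Λ⁺ q m a ▷ (Xalt q m false as ▷ y)) i
      ≈⟨ ▷-congʳ (Λ⁺ q m a) (Xalt-▷ false as y) i ⟩
    ((matPow (Rq q m) a ⊗ W m) ▷ z) i
      ≈⟨ ⊗-▷ (matPow (Rq q m) a) (W m) z i ⟩
    (matPow (Rq q m) a ▷ (W m ▷ z)) i
      ≈⟨ matPow-▷ true Rq-opposite a (W m ▷ z) i ⟩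
    transferAlong (replicate a true) ((W m ▷ z) ∘ opposite) (opposite i)
      ≈⟨ transferAlong-cong (replicate a true) W-▷-reversed (opposite i) ⟩
    transferAlong (replicate a true) z (opposite i)
      ≡⟨ cong (λ f → f (opposite i)) (Listₚ.foldr-++ transfer _ (replicate a true) (blocks false as)) ⟨
    transferAlong (blocks true (a ∷ as)) (endVector (flipPerBlock true (a ∷ as)) y) (opposite i) ∎
    where
    z = transferAlong (blocks false as) (endVector (flipPerBlock false as) y)
    W-▷-reversed : ∀ w → (W m ▷ z) (opposite w) ≈ z w
    W-▷-reversed w = ≈-trans (W-▷ z (opposite w)) (reflexive (cong z (Finₚ.opposite-involutive w)))
  Xalt-▷ false (a ∷ as) y i = begin
    ((Λ⁻ q m a ⊗ Xalt q m true as) ▷ y) i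
      ≈⟨ ⊗-▷ (Λ⁻ q m a) (Xalt q m true as) y i ⟩
    (Λ⁻ q m a ▷ (Xalt q m true as ▷ y)) i
      ≈⟨ ▷-congʳ (Λ⁻ q m a) (Xalt-▷ true as y) i ⟩
    ((W m ⊗ matPow (Lq q m) a) ▷ (z ∘ opposite)) i
      ≈⟨ ⊗-▷ (W m) (matPow (Lq q m) a) (z ∘ opposite) i ⟩
    (W m ▷ (matPow (Lq q m) a ▷ (z ∘ opposite))) i
      ≈⟨ W-▷ (matPow (Lq q m) a ▷ (z ∘ opposite)) i ⟩
    (matPow (Lq q m) a ▷ (z ∘ opposite)) (opposite i)
      ≈⟨ matPow-▷ false Lq-opposite a (z ∘ opposite) (opposite i) ⟩
    transferAlong (replicate a false) (z ∘ opposite ∘ opposite) (opposite (opposite i))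
      ≈⟨ transferAlong-cong (replicate a false) (λ w → reflexive (cong z (Finₚ.opposite-involutive w))) _ ⟩
    transferAlong (replicate a false) z (opposite (opposite i))
      ≡⟨ cong (transferAlong (replicate a false) z) (Finₚ.opposite-involutive i) ⟩
    transferAlong (replicate a false) z i
      ≡⟨ cong (λ f → f i) (Listₚ.foldr-++ transfer _ (replicate a false) (blocks true as)) ⟨
    transferAlong (blocks false (a ∷ as)) (endVector (flipPerBlock false (a ∷ as)) y) i ∎
    where
    z = transferAlong (blocks true as) (endVector (flipPerBlock true as) y)

  finalStep : Bool → Fin (suc m) → Column
  finalStep e j = transfer (not e) (endVector e (unit j))

  finalStep-false : ∀ j v → finalStep false j v ≈ pow q (toℕ j) * [ toℕ j ℕ.≤? toℕ v ]
  finalStep-false j v = ≈-trans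
    (sumFin-δʳ (λ w → toℕ w ℕ.≟ toℕ j) j (λ w → mk⇔ Finₚ.toℕ-injective (cong toℕ)) (transferMatrix true v))
    (*-comm _ _)

  finalStep-true : ∀ j v → finalStep true j v ≈ pow q (m ∸ toℕ j) * [ toℕ v ℕ.≤? m ∸ toℕ j ]
  finalStep-true j v = begin
    transfer false (unit j ∘ opposite) v
      ≈⟨ sumFin-δʳ (λ w → toℕ (opposite w) ℕ.≟ toℕ j) (opposite j) opposite⇔ (transferMatrix false v) ⟩
    [ toℕ v ℕ.≤? toℕ (opposite j) ] * pow q (toℕ (opposite j))
      ≡⟨ cong (λ x → [ toℕ v ℕ.≤? x ] * pow q x) (toℕ-opposite j) ⟩
    [ toℕ v ℕ.≤? m ∸ toℕ j ] * pow q (m ∸ toℕ j)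
      ≈⟨ *-comm _ _ ⟩
    pow q (m ∸ toℕ j) * [ toℕ v ℕ.≤? m ∸ toℕ j ] ∎
    where
    opposite⇔ : ∀ w → toℕ (opposite w) ≡ toℕ j ⇔ w ≡ opposite j
    opposite⇔ w = mk⇔
      (λ e → ≡.trans (≡.sym (Finₚ.opposite-involutive w)) (cong opposite (Finₚ.toℕ-injective e)))
      (λ { refl → cong toℕ (Finₚ.opposite-involutive j) })

  X-transfer : ∀ a i j →
    X q m a i j ≈ transferAlong (blocks true a) (endVector (flipPerBlock true a) (unit j)) (opposite i)
  X-transfer a i j = ≈-trans (≈-sym (▷-unit (X q m a) i j)) (Xalt-▷ true a (unit j) i)

  X-transfer-strip : ∀ a i j → blocks true a ≡ true ∷ (steps a ++ not (flipPerBlock true a) ∷ []) →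
    X q m a i j ≈ transferAlong (true ∷ steps a) (finalStep (flipPerBlock true a) j) (opposite i)
  X-transfer-strip a i j shape = begin
    X q m a i j
      ≈⟨ X-transfer a i j ⟩
    transferAlong (blocks true a) y (opposite i)
      ≡⟨ cong (λ bs → transferAlong bs y (opposite i)) shape ⟩
    transferAlong (true ∷ steps a ++ not e ∷ []) y (opposite i)
      ≡⟨ cong (λ f → f (opposite i)) (Listₚ.foldr-++ transfer y (true ∷ steps a) (not e ∷ [])) ⟩
    transferAlong (true ∷ steps a) (finalStep e j) (opposite i) ∎
    where
    e = flipPerBlock true a
    y = endVector e (unit j)

  -- N is left abstract so that the sums Ω q m a and Ωbar q m a, over nBoxes a boxes, are instances.
  Ω-along : ∀ N s → N ≡ suc (length s) → (pp? : ∀ σ → Dec (IsPPartitionAlong N s σ)) → ∀ i j →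
    sumFillings m N (λ σ → [ pp? σ ×-dec endsΩ? m N i j σ ] * pow q (wt σ))
    ≈ transferAlong (true ∷ s) (λ w → [ toℕ w ℕ.≤? m ∸ toℕ j ]) (opposite i)
  Ω-along _ s refl pp? i j = sumFillings-strip s (λ w → toℕ w ℕ.≤? m ∸ toℕ j) pp? i

  Ωbar-along : ∀ N s → N ≡ suc (length s) → (pp? : ∀ σ → Dec (IsPPartitionAlong N s σ)) → ∀ i j →
    sumFillings m N (λ σ → [ pp? σ ×-dec endsΩbar? m N i j σ ] * pow q (wt σ))
    ≈ transferAlong (true ∷ s) (λ w → [ toℕ j ℕ.≤? toℕ w ]) (opposite i)
  Ωbar-along _ s refl pp? i j = sumFillings-strip s (λ w → toℕ j ℕ.≤? toℕ w) pp? i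

  X-even : ∀ a i j → blocks true a ≡ true ∷ (steps a ++ not (flipPerBlock true a) ∷ []) →
    isEven (length a) ≡ true → X q m a i j ≈ pow q (m ∸ toℕ j) * Ω q m a i j
  X-even a i j shape even = begin
    X q m a i j
      ≈⟨ X-transfer-strip a i j shape ⟩
    transferAlong (true ∷ steps a) (finalStep (flipPerBlock true a) j) (opposite i)
      ≡⟨ cong (λ e → transferAlong (true ∷ steps a) (finalStep e j) (opposite i))
              (≡.trans (flipPerBlock-true a) even) ⟩
    transferAlong (true ∷ steps a) (finalStep true j) (opposite i)
      ≈⟨ transferAlong-cong (true ∷ steps a) (finalStep-true j) (opposite i) ⟩
    transferAlong (true ∷ steps a) (λ w → pow q (m ∸ toℕ j) * [ toℕ w ℕ.≤? m ∸ toℕ j ]) (opposite i)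
      ≈⟨ transferAlong-*ˡ (true ∷ steps a) (pow q (m ∸ toℕ j)) _ (opposite i) ⟩
    pow q (m ∸ toℕ j) * transferAlong (true ∷ steps a) (λ w → [ toℕ w ℕ.≤? m ∸ toℕ j ]) (opposite i)
      ≈⟨ *-congˡ (Ω-along (nBoxes a) (steps a) (nBoxes-shape a _ _ shape) (isPPartition? m a) i j) ⟨
    pow q (m ∸ toℕ j) * Ω q m a i j ∎

  X-odd : ∀ a i j → blocks true a ≡ true ∷ (steps a ++ not (flipPerBlock true a) ∷ []) →
    isEven (length a) ≡ false → X q m a i j ≈ pow q (toℕ j) * Ωbar q m a i j
  X-odd a i j shape odd = begin
    X q m a i j
      ≈⟨ X-transfer-strip a i j shape ⟩
    transferAlong (true ∷ steps a) (finalStep (flipPerBlock true a) j) (opposite i)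
      ≡⟨ cong (λ e → transferAlong (true ∷ steps a) (finalStep e j) (opposite i))
              (≡.trans (flipPerBlock-true a) odd) ⟩
    transferAlong (true ∷ steps a) (finalStep false j) (opposite i)
      ≈⟨ transferAlong-cong (true ∷ steps a) (finalStep-false j) (opposite i) ⟩
    transferAlong (true ∷ steps a) (λ w → pow q (toℕ j) * [ toℕ j ℕ.≤? toℕ w ]) (opposite i)
      ≈⟨ transferAlong-*ˡ (true ∷ steps a) (pow q (toℕ j)) _ (opposite i) ⟩
    pow q (toℕ j) * transferAlong (true ∷ steps a) (λ w → [ toℕ j ℕ.≤? toℕ w ]) (opposite i)
      ≈⟨ *-congˡ (Ωbar-along (nBoxes a) (steps a) (nBoxes-shape a _ _ shape) (isPPartition? m a) i j) ⟨
    pow q (toℕ j) * Ωbar q m a i j ∎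

  X-emptyStrip : ∀ i j → X q m (1 ∷ []) i j ≈ pow q (toℕ j) * Ωbar q m (1 ∷ []) i j
  X-emptyStrip i j = begin
    X q m (1 ∷ []) i j
      ≈⟨ X-transfer (1 ∷ []) i j ⟩
    finalStep false j (opposite i)
      ≈⟨ finalStep-false j (opposite i) ⟩
    pow q (toℕ j) * [ toℕ j ℕ.≤? toℕ (opposite i) ]
      ≡⟨ cong (pow q (toℕ j) *_) ([]-⇔ empty⇔ (toℕ j ℕ.≤? toℕ (opposite i)) noBoxes?) ⟩
    pow q (toℕ j) * [ noBoxes? ]
      ≈⟨ *-congˡ (*-identityʳ _) ⟨
    pow q (toℕ j) * Ωbar q m (1 ∷ []) i j ∎
    where
    noBoxes? = isPPartition? m (1 ∷ []) (λ ()) ×-dec (toℕ j ℕ.≤? m ∸ toℕ i)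
    empty⇔ : toℕ j ≤ toℕ (opposite i) ⇔ (IsPPartition m (1 ∷ []) (λ ()) × toℕ j ≤ m ∸ toℕ i)
    empty⇔ = mk⇔ (λ j≤ → ((λ ()) , (λ ())) , ≡.subst (_ ≤_) (toℕ-opposite i) j≤)
                 (λ (_ , j≤) → ≡.subst (_ ≤_) (≡.sym (toℕ-opposite i)) j≤)

theoremA : ∀ {c ℓ} (R : CommutativeSemiring c ℓ) (q : CommutativeSemiring.Carrier R)
    (m : ℕ) → 1 ≤ m → (a : List ℕ) → 1 ≤ length a → All (λ x → 1 ≤ x) a →
    (i j : Fin (suc m)) →
    let open CommutativeSemiring R
        open Over R
    in (isEven (length a) ≡ true → X q m a i j ≈ pow q (m ∸ toℕ j) * Ω q m a i j)
       × (isEven (length a) ≡ false → X q m a i j ≈ pow q (toℕ j) * Ωbar q m a i j)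
-- The identity holds for m = 0 as well.
theoremA R q m _ a len pos i j with blocks-shape a len pos
... | inj₁ refl  = (λ ()) , (λ _ → Transfer.X-emptyStrip R q m i j)
... | inj₂ shape = Transfer.X-even R q m a i j shape , Transfer.X-odd R q m a i j shape
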